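{- Let $d\ge3$, $h\ge1$. The exponent $\exp(d,h)$ of the sandpile group $G(d,h)$ divides $$(d-1)^h\,\mathrm{lcm}\{d\,\theta(d,h+1),\theta(d,h),\theta(d,h-1),\dots,\theta(d,2)\},$$ where $\theta(d,n)=\frac{(d-1)^n-1}{d-2}$.
   Context: Let $\mathcal{T}(d,h)$ be the ball of radius $h$ about a root vertex $0$ in the infinite $d$-regular tree (root has $d$ children, vertices at depth $1,\dots,h-1$ have $d-1$ children, depth-$h$ vertices are leaves). Let $V$ be its vertex set, $p(i)$ the parent of $i\neq 0$, $C_i$ the children of $i$, $\{\mathbf{x}_i\}$ the standard basis of $\mathbb{Z}^V$, and $\delta_i = d\mathbf{x}_i - \mathbf{x}_{p(i)} - \sum_{j\in C_i}\mathbf{x}_j$ (omit $\mathbf{x}_{p(i)}$ for $i=0$). The sandpile group is $G(d,h)=\mathbb{Z}^V/\sum_{i\in V}\mathbb{Z}\delta_i$; its exponent is the lcm of the orders of its elements. -}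

module Defs where

open import Data.Nat as ℕ using (ℕ; zero; suc; _∸_; _^_; _<ᵇ_)
open import Data.Nat.DivMod using (_/_)
open import Data.Nat.LCM using (lcm)
open import Data.Fin using (Fin; zero; suc)
open import Data.Integer using (ℤ; +_; _+_; _-_; _*_; 0ℤ)
open import Data.Bool using (if_then_else_)
open import Data.Product using (∃)
open import Relation.Binary.PropositionalEquality using (_≡_)

-- Vertices of the (infinite) d-regular tree, indexed by their depth.
-- root : the root 0;  top a : the a-th child of the root (a < d);
-- ext v b : the b-th child of a non-root vertex v (b < d-1).
data Vtx (d : ℕ) : ℕ → Set where
  root : Vtx d 0
  top  : Fin d → Vtx d 1
  ext  : ∀ {k} → Vtx d (suc k) → Fin (d ∸ 1) → Vtx d (suc (suc k))

-- Vertex set of T(d,h): vertices of depth k with k ≤ h.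
-- Elements of ℤ^V: integer functions on vertices (only depths ≤ h matter).
Config : ℕ → Set
Config d = ∀ {k} → Vtx d k → ℤ

sumFin : (n : ℕ) → (Fin n → ℤ) → ℤ
sumFin zero    f = 0ℤ
sumFin (suc n) f = f zero + sumFin n (λ i → f (suc i))

childSum : (d h : ℕ) → Config d → ∀ {k} → Vtx d k → ℤ
childSum d h c {k} v = if k <ᵇ h then allChildren v else 0ℤ
  where
  allChildren : ∀ {k} → Vtx d k → ℤ
  allChildren root      = sumFin d (λ a → c (top a))
  allChildren (top a)   = sumFin (d ∸ 1) (λ b → c (ext (top a) b))
  allChildren (ext w b) = sumFin (d ∸ 1) (λ b' → c (ext (ext w b) b'))

-- Coordinate at v of  Σ_i c_i δ_i  (δ_i = d x_i - x_{p(i)} - Σ_{j∈C_i} x_j),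
-- i.e. d c_v - c_{p(v)} - Σ_{j ∈ C_v} c_j  (no parent term at the root).
combo : (d h : ℕ) → Config d → ∀ {k} → Vtx d k → ℤ
combo d h c root      = (+ d) * c root - childSum d h c root
combo d h c (top a)   = (+ d) * c (top a) - c root - childSum d h c (top a)
combo d h c (ext w b) = (+ d) * c (ext w b) - c w - childSum d h c (ext w b)

InLattice : (d h : ℕ) → Config d → Set
InLattice d h y =
  ∃ λ (c : Config d) → ∀ {k} → k ℕ.≤ h → (v : Vtx d k) → y v ≡ combo d h c v

OrderDivides : (d h : ℕ) → Config d → ℕ → Set
OrderDivides d h x N = InLattice d h (λ v → (+ N) * x v)

-- exp(d,h) ∣ N  ⇔  the order of every element of G(d,h) divides N
-- (exponent = lcm of the orders).
ExponentDivides : (d h : ℕ) → ℕ → Set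
ExponentDivides d h N = (x : Config d) → OrderDivides d h x N

-- θ(d,n) = ((d-1)^n - 1)/(d-2)  (exact for d ≥ 3; junk value 0 when d ≤ 2)
θ : ℕ → ℕ → ℕ
θ d n = go (d ∸ 2)
  where
  go : ℕ → ℕ
  go zero    = 0
  go (suc m) = ((d ∸ 1) ^ n ∸ 1) / suc m

lcmθ : ℕ → ℕ → ℕ
lcmθ d zero          = 1
lcmθ d (suc zero)    = 1
lcmθ d (suc (suc n)) = lcm (θ d (suc (suc n))) (lcmθ d (suc n))

bound : ℕ → ℕ → ℕ
bound d h = (d ∸ 1) ^ h ℕ.* lcm (d ℕ.* θ d (suc h)) (lcmθ d h)

-- Write q = d - 1, ρ(v) = h - depth(v) for the height of a vertex, and a_ρ = θ(d, ρ + 1) =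
-- 1 + q + ⋯ + q^ρ, so that d a_ρ = a_{ρ+1} + q a_{ρ-1}.  For x ∈ ℤ^V let P(v) = Σ a_{ρ(u)} x_u
-- over the vertices u of the subtree rooted at v, and put
--   c_v = a_{ρ(v)} (m P(0) + Σ n_{ρ(w)} P(w)),   w ≠ 0 ranging over the path from the root to v,
-- with n_ρ = N / (a_{ρ+1} a_ρ) and m = N / (d q^h a_h).  In the v-coordinate of Σ c_i δ_i the
-- recurrence for a cancels the parent's term, n_ρ a_{ρ+1} = N / a_ρ = n_{ρ-1} a_{ρ-1} cancels the
-- subtree sums of the children, and n_ρ a_{ρ+1} a_ρ x_v = N x_v is left; at the root
-- m d q^h = N / a_h = n_{h-1} a_{h-1} does the same job.  So N annihilates G(d,h) whenever these
-- quotients are integers.  For N = q^h L with L = lcm{d θ(d,h+1), θ(d,h), …, θ(d,2)} they are: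
-- d a_h divides L, and a_{ρ+1} a_ρ divides L because every a_ρ = θ(d, ρ + 1) with ρ ≤ h does
-- and consecutive a's are coprime.

module Submission where

open import Defs
open import Data.Nat using (ℕ; _≤_)

open import Data.Nat as Nat using (zero; suc; _∸_; _^_; _<_; _<ᵇ_; z≤n; s≤s; _≤′_; ≤′-refl; ≤′-reflexive; ≤′-step)
open import Data.Nat.Properties using (+-comm; <⇒≤; ≤⇒≤′; m≤n⇒m<n∨m≡n)
open import Data.Nat.Divisibility using (_∣_; ∣-trans; 1∣_; ∣1⇒≡1; ∣m+n∣m⇒∣n; n∣m*n; ∣m⇒∣m*n; ∣n⇒∣m*n; *-monoʳ-∣)
open import Data.Nat.Coprimality using (Coprime; coprime⇒gcd≡1) renaming (sym to coprime-sym)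
open import Data.Nat.LCM using (lcm; m∣lcm[m,n]; n∣lcm[m,n]; lcm-least; gcd*lcm)
open import Data.Nat.DivMod using (_/_; m*n/n≡m; m/n*n≡m)
open import Data.Integer using (ℤ; +_; 0ℤ)
open import Data.Fin using (Fin; zero; suc)
open import Data.Bool using (true; false)
open import Data.Sum using (inj₁; inj₂)
open import Data.Product using (_,_)
open import Data.List using (_∷_; [])
open import Relation.Nullary using (contradiction)
open import Relation.Binary.PropositionalEquality

∸-suc : ∀ {m n} → n < m → m ∸ n ≡ suc (m ∸ suc n)
∸-suc {suc m} {zero}  _         = refl
∸-suc {suc m} {suc n} (s≤s n<m) = ∸-suc n<m

module Repunits where
  open import Data.Nat using (_+_; _*_)
  open import Data.Nat.Tactic.RingSolver using (solve-∀)

  repunit : ℕ → ℕ → ℕ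
  repunit q zero    = 0
  repunit q (suc n) = suc (repunit q n * q)

  repunit-suc-pow : ∀ q n → repunit q (suc n) ≡ repunit q n + q ^ n
  repunit-suc-pow q zero    = refl
  repunit-suc-pow q (suc n) =
    trans (cong (λ r → suc (r * q)) (repunit-suc-pow q n)) (lemma (repunit q n) (q ^ n) q)
    where
    lemma : ∀ r p q → suc ((r + p) * q) ≡ suc (r * q) + q * p
    lemma = solve-∀

  repunit-harmonic : ∀ q n → suc q * repunit q (suc n) ≡ repunit q (suc (suc n)) + q * repunit q n
  repunit-harmonic q n = lemma q (repunit q n)
    where
    lemma : ∀ q r → suc q * suc (r * q) ≡ suc (suc (r * q) * q) + q * r
    lemma = solve-∀

  repunit-geometric : ∀ p n → suc (repunit (suc p) n * p) ≡ suc p ^ n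
  repunit-geometric p zero    = refl
  repunit-geometric p (suc n) =
    trans (lemma p (repunit (suc p) n)) (cong (suc p *_) (repunit-geometric p n))
    where
    lemma : ∀ p r → suc (suc (r * suc p) * p) ≡ suc p * suc (r * p)
    lemma = solve-∀

  repunit-suc-coprime : ∀ q n → Coprime (repunit q n) (repunit q (suc n))
  repunit-suc-coprime q n {i} (i∣r , i∣1+rq) =
    ∣1⇒≡1 (∣m+n∣m⇒∣n (subst (i ∣_) (+-comm 1 (repunit q n * q)) i∣1+rq) (∣m⇒∣m*n q i∣r))

  θ≡repunit : ∀ e n → θ (3 + e) n ≡ repunit (2 + e) n
  θ≡repunit e n = begin
    (suc (suc e) ^ n ∸ 1) / suc e                    ≡⟨ cong (λ t → (t ∸ 1) / suc e) (sym (repunit-geometric (suc e) n)) ⟩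
    repunit (2 + e) n * suc e / suc e                ≡⟨ m*n/n≡m (repunit (2 + e) n) (suc e) ⟩
    repunit (2 + e) n                                ∎
    where open ≡-Reasoning

open Repunits

module LcmBound where
  open import Data.Nat using (_+_; _*_)
  open import Data.Nat.Properties using (*-identityˡ; *-assoc; *-comm)

  lcmFactor : ℕ → ℕ → ℕ
  lcmFactor d h = lcm (d * θ d (suc h)) (lcmθ d h)

  coprime⇒*∣ : ∀ {m n o} → Coprime m n → m ∣ o → n ∣ o → m * n ∣ o
  coprime⇒*∣ {m} {n} m⊥n m∣o n∣o = subst (_∣ _) lcm≡* (lcm-least m∣o n∣o)
    where
    lcm≡* : lcm m n ≡ m * n
    lcm≡* = trans (sym (*-identityˡ (lcm m n)))
                  (trans (cong (_* lcm m n) (sym (coprime⇒gcd≡1 m⊥n))) (gcd*lcm m n))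

  θ∣lcmθ : ∀ d {j n} → 2 ≤ j → j ≤′ n → θ d j ∣ lcmθ d n
  θ∣lcmθ d (s≤s (s≤s _)) ≤′-refl = m∣lcm[m,n] _ _
  θ∣lcmθ d (s≤s (s≤s _)) (≤′-step {zero} (≤′-reflexive ()))
  θ∣lcmθ d 2≤j (≤′-step {suc n} j≤n) =
    ∣-trans (θ∣lcmθ d 2≤j j≤n) (n∣lcm[m,n] (θ d (2 + n)) (lcmθ d (suc n)))

  θ∣lcmFactor : ∀ d h {j} → 2 ≤ j → j ≤ suc h → θ d j ∣ lcmFactor d h
  θ∣lcmFactor d h 2≤j j≤1+h with m≤n⇒m<n∨m≡n j≤1+h
  ... | inj₁ (s≤s j≤h) = ∣-trans (θ∣lcmθ d 2≤j (≤⇒≤′ j≤h)) (n∣lcm[m,n] (d * θ d (suc h)) (lcmθ d h))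
  ... | inj₂ refl      = ∣-trans (n∣m*n d) (m∣lcm[m,n] (d * θ d (suc h)) (lcmθ d h))

  repunit∣lcmFactor : ∀ e h {j} → j ≤ h → repunit (2 + e) (suc j) ∣ lcmFactor (3 + e) h
  repunit∣lcmFactor e h {zero}  _   = 1∣ _
  repunit∣lcmFactor e h {suc j} 1+j≤h =
    subst (_∣ lcmFactor (3 + e) h) (θ≡repunit e (2 + j)) (θ∣lcmFactor (3 + e) h (s≤s (s≤s z≤n)) (s≤s 1+j≤h))

  consecutive∣bound : ∀ e h r → r < h → repunit (2 + e) (2 + r) * repunit (2 + e) (suc r) ∣ bound (3 + e) h
  consecutive∣bound e h r r<h =
    ∣n⇒∣m*n ((2 + e) ^ h)
      (coprime⇒*∣ (coprime-sym (repunit-suc-coprime (2 + e) (suc r)))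
                  (repunit∣lcmFactor e h r<h) (repunit∣lcmFactor e h (<⇒≤ r<h)))

  root∣bound : ∀ e h → (3 + e) * (2 + e) ^ h * repunit (2 + e) (suc h) ∣ bound (3 + e) h
  root∣bound e h = subst (_∣ bound (3 + e) h) rearrange
    (*-monoʳ-∣ ((2 + e) ^ h) (m∣lcm[m,n] ((3 + e) * θ (3 + e) (suc h)) (lcmθ (3 + e) h)))
    where
    rearrange : (2 + e) ^ h * ((3 + e) * θ (3 + e) (suc h)) ≡ (3 + e) * (2 + e) ^ h * repunit (2 + e) (suc h)
    rearrange = begin
      (2 + e) ^ h * ((3 + e) * θ (3 + e) (suc h))       ≡⟨ sym (*-assoc ((2 + e) ^ h) (3 + e) _) ⟩
      (2 + e) ^ h * (3 + e) * θ (3 + e) (suc h)         ≡⟨ cong₂ _*_ (*-comm ((2 + e) ^ h) (3 + e)) (θ≡repunit e (suc h)) ⟩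
      (3 + e) * (2 + e) ^ h * repunit (2 + e) (suc h)   ∎
      where open ≡-Reasoning

open LcmBound

module ChildSums where
  open import Data.Integer using (_+_; _*_; 1ℤ)
  open import Data.Integer.Tactic.RingSolver using (solve-∀)
  open import Data.Nat.Properties using (<⇒<ᵇ; <ᵇ⇒<; n≮n)

  sumFin-linear : ∀ m (a b c : ℤ) (f : Fin m → ℤ) →
    sumFin m (λ i → a * (b + c * f i)) ≡ + m * (a * b) + a * c * sumFin m f
  sumFin-linear zero    a b c f = lemma a b c
    where
    lemma : ∀ a b c → 0ℤ ≡ 0ℤ * (a * b) + a * c * 0ℤ
    lemma = solve-∀
  sumFin-linear (suc m) a b c f =
    trans (cong (λ t → a * (b + c * f zero) + t) (sumFin-linear m a b c (λ i → f (suc i))))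
          (lemma a b c (f zero) (sumFin m (λ i → f (suc i))) (+ m))
    where
    lemma : ∀ a b c y s M → a * (b + c * y) + (M * (a * b) + a * c * s) ≡ (1ℤ + M) * (a * b) + a * c * (y + s)
    lemma = solve-∀

  sumChildren : ∀ {d k} → (Vtx d (suc k) → ℤ) → Vtx d k → ℤ
  sumChildren {d} f root      = sumFin d (λ a → f (top a))
  sumChildren {d} f (top a)   = sumFin (d ∸ 1) (λ b → f (ext (top a) b))
  sumChildren {d} f (ext w b) = sumFin (d ∸ 1) (λ b′ → f (ext (ext w b) b′))

  sumChildren-nonroot : ∀ {d k} (f : Vtx d (suc (suc k)) → ℤ) (v : Vtx d (suc k)) →
    sumChildren f v ≡ sumFin (d ∸ 1) (λ b → f (ext v b))
  sumChildren-nonroot f (top a)   = refl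
  sumChildren-nonroot f (ext w b) = refl

  childSum-internal : ∀ d h (c : Config d) {k} → k < h → (v : Vtx d k) → childSum d h c v ≡ sumChildren c v
  childSum-internal d h c {k} k<h v with k <ᵇ h | <⇒<ᵇ k<h
  childSum-internal d h c k<h root      | true | _ = refl
  childSum-internal d h c k<h (top a)   | true | _ = refl
  childSum-internal d h c k<h (ext w b) | true | _ = refl

  childSum-leaf : ∀ d h (c : Config d) (v : Vtx d h) → childSum d h c v ≡ 0ℤ
  childSum-leaf d h c v with h <ᵇ h | <ᵇ⇒< h h
  ... | false | _   = refl
  ... | true  | h<h = contradiction (h<h _) (n≮n h)

open ChildSums

module Balance where
  open import Data.Integer using (_+_; _*_; _-_)
  open import Data.Integer.Tactic.RingSolver using (solve)
  open ≡-Reasoning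

  balance : ∀ {d q a a′ a″ n n′ Kₚ K P x S N : ℤ} →
    d * a ≡ a″ + q * a′ → n * a″ ≡ n′ * a′ → N ≡ n * (a″ * a) →
    K ≡ Kₚ + n * P → P ≡ x * a + S →
    d * (a * K) - a″ * Kₚ - (q * (a′ * K) + a′ * n′ * S) ≡ N * x
  balance {d} {q} {a} {a′} {a″} {n} {n′} {Kₚ} {K} {P} {x} {S} harmonic continuity refl K≡ P≡ = begin
    d * (a * K) - a″ * Kₚ - (q * (a′ * K) + a′ * n′ * S)
      ≡⟨ solve (d ∷ q ∷ a ∷ a′ ∷ a″ ∷ n′ ∷ K ∷ Kₚ ∷ S ∷ []) ⟩
    (d * a) * K - q * a′ * K - a″ * Kₚ - (n′ * a′) * S
      ≡⟨ cong₂ (λ u v → u * K - q * a′ * K - a″ * Kₚ - v * S) harmonic (sym continuity) ⟩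
    (a″ + q * a′) * K - q * a′ * K - a″ * Kₚ - (n * a″) * S
      ≡⟨ cong (λ u → (a″ + q * a′) * u - q * a′ * u - a″ * Kₚ - (n * a″) * S) (trans K≡ (cong (λ u → Kₚ + n * u) P≡)) ⟩
    (a″ + q * a′) * (Kₚ + n * (x * a + S)) - q * a′ * (Kₚ + n * (x * a + S)) - a″ * Kₚ - (n * a″) * S
      ≡⟨ solve (q ∷ a ∷ a′ ∷ a″ ∷ n ∷ Kₚ ∷ x ∷ S ∷ []) ⟩
    n * (a″ * a) * x ∎

  balance-leaf : ∀ {d a a″ n Kₚ K P x N : ℤ} →
    d * a ≡ a″ → N ≡ n * (a″ * a) → K ≡ Kₚ + n * P → P ≡ x * a →
    d * (a * K) - a″ * Kₚ - 0ℤ ≡ N * x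
  balance-leaf {d} {a} {a″} {n} {Kₚ} {K} {P} {x} harmonic refl K≡ P≡ = begin
    d * (a * K) - a″ * Kₚ - 0ℤ
      ≡⟨ solve (d ∷ a ∷ a″ ∷ K ∷ Kₚ ∷ []) ⟩
    (d * a) * K - a″ * Kₚ
      ≡⟨ cong₂ (λ u v → u * v - a″ * Kₚ) harmonic (trans K≡ (cong (λ u → Kₚ + n * u) P≡)) ⟩
    a″ * (Kₚ + n * (x * a)) - a″ * Kₚ
      ≡⟨ solve (a ∷ a″ ∷ n ∷ Kₚ ∷ x ∷ []) ⟩
    n * (a″ * a) * x ∎

  balance-root : ∀ {d t a a′ m n′ K P x S N : ℤ} →
    a ≡ a′ + t → m * (d * t) ≡ n′ * a′ → N ≡ n′ * (a * a′) →
    K ≡ m * P → P ≡ x * a + S →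
    d * (a * K) - (d * (a′ * K) + a′ * n′ * S) ≡ N * x
  balance-root {d} {t} {a} {a′} {m} {n′} {K} {P} {x} {S} a≡ continuity refl K≡ P≡ = begin
    d * (a * K) - (d * (a′ * K) + a′ * n′ * S)
      ≡⟨ cong (λ u → d * (u * K) - (d * (a′ * K) + a′ * n′ * S)) a≡ ⟩
    d * ((a′ + t) * K) - (d * (a′ * K) + a′ * n′ * S)
      ≡⟨ solve (d ∷ t ∷ a′ ∷ n′ ∷ K ∷ S ∷ []) ⟩
    d * t * K - (n′ * a′) * S
      ≡⟨ cong₂ (λ u v → d * t * u - v * S) (trans K≡ (cong (m *_) P≡)) (sym continuity) ⟩
    d * t * (m * (x * a + S)) - m * (d * t) * S
      ≡⟨ solve (d ∷ t ∷ a ∷ m ∷ x ∷ S ∷ []) ⟩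
    m * (d * t) * a * x
      ≡⟨ cong (λ u → u * a * x) continuity ⟩
    n′ * a′ * a * x
      ≡⟨ solve (a ∷ a′ ∷ n′ ∷ x ∷ []) ⟩
    n′ * (a * a′) * x ∎

open Balance

module Solution
    (q g N m : ℕ) (n : ℕ → ℕ)
    (root-quotient : N ≡ m Nat.* (suc q Nat.* q ^ suc g Nat.* repunit q (suc (suc g))))
    (quotient : ∀ r → r < suc g → N ≡ n r Nat.* (repunit q (suc (suc r)) Nat.* repunit q (suc r)))
    (x : Config (suc q)) where

  open import Data.Integer using (_+_; _*_; _-_)
  open import Data.Integer.Properties using (pos-+; pos-*)
  open import Data.Nat.Properties using (*-assoc; *-comm; *-cancelʳ-≡; *-identityˡ; *-identityʳ; n∸n≡0; m∸n≤m; n<1+n; <-trans)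

  private
    d h : ℕ
    d = suc q
    h = suc g

  A : ℕ → ℕ
  A ρ = repunit q (suc ρ)

  α : ℕ → ℤ
  α ρ = + A ρ

  weightedSubtreeSum : ℕ → ∀ {k} → Vtx d k → ℤ
  weightedSubtreeSum zero    v = x v * α 0
  weightedSubtreeSum (suc ρ) v = x v * α (suc ρ) + sumChildren (weightedSubtreeSum ρ) v

  subtree : ∀ {k} → Vtx d k → ℤ
  subtree {k} = weightedSubtreeSum (h ∸ k)

  pathSum : ∀ {k} → Vtx d k → ℤ
  pathSum root          = + m * subtree root
  pathSum (top a)       = pathSum root + + n (h ∸ 1) * subtree (top a)
  pathSum (ext {k} w b) = pathSum w + + n (h ∸ suc (suc k)) * subtree (ext w b)

  solution : Config d
  solution {k} v = α (h ∸ k) * pathSum v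

  continuity : ∀ σ → suc σ < h → n (suc σ) Nat.* A (suc (suc σ)) ≡ n σ Nat.* A σ
  continuity σ lt = *-cancelʳ-≡ _ _ (A (suc σ)) (begin
    n (suc σ) Nat.* A (suc (suc σ)) Nat.* A (suc σ)   ≡⟨ *-assoc (n (suc σ)) _ _ ⟩
    n (suc σ) Nat.* (A (suc (suc σ)) Nat.* A (suc σ)) ≡⟨ sym (quotient (suc σ) lt) ⟩
    N                                                 ≡⟨ quotient σ (<-trans (n<1+n σ) lt) ⟩
    n σ Nat.* (A (suc σ) Nat.* A σ)                   ≡⟨ cong (n σ Nat.*_) (*-comm (A (suc σ)) (A σ)) ⟩
    n σ Nat.* (A σ Nat.* A (suc σ))                   ≡⟨ sym (*-assoc (n σ) _ _) ⟩
    n σ Nat.* A σ Nat.* A (suc σ)                     ∎)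
    where open ≡-Reasoning

  root-continuity : m Nat.* (d Nat.* q ^ h) ≡ n g Nat.* A g
  root-continuity = *-cancelʳ-≡ _ _ (A h) (begin
    m Nat.* (d Nat.* q ^ h) Nat.* A h   ≡⟨ *-assoc m _ _ ⟩
    m Nat.* (d Nat.* q ^ h Nat.* A h)   ≡⟨ sym root-quotient ⟩
    N                                   ≡⟨ quotient g (n<1+n g) ⟩
    n g Nat.* (A h Nat.* A g)           ≡⟨ cong (n g Nat.*_) (*-comm (A h) (A g)) ⟩
    n g Nat.* (A g Nat.* A h)           ≡⟨ sym (*-assoc (n g) _ _) ⟩
    n g Nat.* A g Nat.* A h             ∎)
    where open ≡-Reasoning

  pos-*-≡ : ∀ a b c e → a Nat.* b ≡ c Nat.* e → + a * + b ≡ + c * + e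
  pos-*-≡ a b c e eq = trans (sym (pos-* a b)) (trans (cong +_ eq) (pos-* c e))

  α-continuity : ∀ σ → suc σ < h → + n (suc σ) * α (suc (suc σ)) ≡ + n σ * α σ
  α-continuity σ lt = pos-*-≡ (n (suc σ)) (A (suc (suc σ))) (n σ) (A σ) (continuity σ lt)

  α-root-continuity : + m * (+ d * + (q ^ h)) ≡ + n g * α g
  α-root-continuity = trans (cong (λ t → + m * t) (sym (pos-* d (q ^ h))))
                            (pos-*-≡ m (d Nat.* q ^ h) (n g) (A g) root-continuity)

  α-harmonic : ∀ σ → + d * α (suc σ) ≡ α (suc (suc σ)) + + q * α σ
  α-harmonic σ = begin
    + d * α (suc σ)                          ≡⟨ sym (pos-* d (A (suc σ))) ⟩
    + (d Nat.* A (suc σ))                    ≡⟨ cong +_ (repunit-harmonic q (suc σ)) ⟩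
    + (A (suc (suc σ)) Nat.+ q Nat.* A σ)    ≡⟨ pos-+ (A (suc (suc σ))) (q Nat.* A σ) ⟩
    α (suc (suc σ)) + + (q Nat.* A σ)        ≡⟨ cong (λ t → α (suc (suc σ)) + t) (pos-* q (A σ)) ⟩
    α (suc (suc σ)) + + q * α σ              ∎
    where open ≡-Reasoning

  α-root : α h ≡ α g + + (q ^ h)
  α-root = trans (cong +_ (repunit-suc-pow q h)) (pos-+ (A g) (q ^ h))

  flux : ∀ r → r < h → + N ≡ + n r * (α (suc r) * α r)
  flux r r<h = trans (cong +_ (quotient r r<h)) (trans (pos-* (n r) _) (cong (λ t → + n r * t) (pos-* (A (suc r)) (A r))))

  height<h : ∀ k → h ∸ suc k < h
  height<h k = s≤s (m∸n≤m g k)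

  harmonic-at : ∀ {k} → suc k < h → + d * α (h ∸ suc k) ≡ α (h ∸ k) + + q * α (h ∸ suc (suc k))
  harmonic-at {k} lt rewrite ∸-suc (<-trans (n<1+n k) lt) | ∸-suc lt = α-harmonic (h ∸ suc (suc k))

  continuity-at : ∀ {k} → suc k < h →
    + n (h ∸ suc k) * α (h ∸ k) ≡ + n (h ∸ suc (suc k)) * α (h ∸ suc (suc k))
  continuity-at {k} lt rewrite ∸-suc (<-trans (n<1+n k) lt) | ∸-suc lt =
    α-continuity (h ∸ suc (suc k)) (subst (_< h) (∸-suc lt) (height<h k))

  flux-at : ∀ {k} → k < h → + N ≡ + n (h ∸ suc k) * (α (h ∸ k) * α (h ∸ suc k))
  flux-at {k} lt rewrite ∸-suc lt = flux (h ∸ suc k) (height<h k)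

  harmonic-leaf : + d * α (h ∸ h) ≡ α (h ∸ g)
  harmonic-leaf rewrite ∸-suc (n<1+n g) | n∸n≡0 g = cong +_ (trans (*-identityʳ d) (cong suc (sym (*-identityˡ q))))

  subtree-internal : ∀ {k} → suc k < h → (v : Vtx d (suc k)) →
    subtree v ≡ x v * α (h ∸ suc k) + sumFin q (λ b → subtree (ext v b))
  subtree-internal {k} lt v rewrite ∸-suc lt =
    cong (λ t → x v * α (suc (h ∸ suc (suc k))) + t) (sumChildren-nonroot (weightedSubtreeSum (h ∸ suc (suc k))) v)

  subtree-leaf : (v : Vtx d h) → subtree v ≡ x v * α (h ∸ h)
  subtree-leaf v rewrite n∸n≡0 g = refl

  childSum-solution : ∀ {k} → suc k < h → (v : Vtx d (suc k)) →
    childSum d h solution v ≡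
      + q * (α (h ∸ suc (suc k)) * pathSum v) + α (h ∸ suc (suc k)) * + n (h ∸ suc (suc k)) * sumFin q (λ b → subtree (ext v b))
  childSum-solution {k} lt v =
    trans (childSum-internal d h solution lt v)
          (trans (sumChildren-nonroot solution v)
                 (sumFin-linear q (α (h ∸ suc (suc k))) (pathSum v) (+ n (h ∸ suc (suc k))) (λ b → subtree (ext v b))))

  childSum-solution-root : childSum d h solution root ≡ + d * (α g * pathSum root) + α g * + n g * sumFin d (λ a → subtree (top a))
  childSum-solution-root =
    trans (childSum-internal d h solution (s≤s z≤n) root) (sumFin-linear d (α g) (pathSum root) (+ n g) (λ a → subtree (top a)))

  vertex-balance : ∀ {k} → suc k ≤ h → (v : Vtx d (suc k)) → ∀ Kₚ →
    pathSum v ≡ Kₚ + + n (h ∸ suc k) * subtree v →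
    + d * solution v - α (h ∸ k) * Kₚ - childSum d h solution v ≡ + N * x v
  vertex-balance {k} le v Kₚ K≡ with m≤n⇒m<n∨m≡n le
  ... | inj₁ lt =
    trans (cong (λ t → + d * solution v - α (h ∸ k) * Kₚ - t) (childSum-solution lt v))
          (balance {d = + d} {q = + q} {n = + n (h ∸ suc k)} {n′ = + n (h ∸ suc (suc k))}
                   (harmonic-at lt) (continuity-at lt) (flux-at (<-trans (n<1+n k) lt)) K≡ (subtree-internal lt v))
  ... | inj₂ refl =
    trans (cong (λ t → + d * solution v - α (h ∸ g) * Kₚ - t) (childSum-leaf d h solution v))
          (balance-leaf {d = + d} {n = + n (h ∸ h)} harmonic-leaf (flux-at (n<1+n g)) K≡ (subtree-leaf v))

  root-balance : + d * solution root - childSum d h solution root ≡ + N * x root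
  root-balance =
    trans (cong (λ t → + d * solution root - t) childSum-solution-root)
          (balance-root {d = + d} {t = + (q ^ h)} {a′ = α g} {m = + m} {n′ = + n g}
                        α-root α-root-continuity (flux g (n<1+n g)) refl refl)

  solves : ∀ {k} → k ≤ h → (v : Vtx d k) → + N * x v ≡ combo d h solution v
  solves _  root      = sym root-balance
  solves _  (top a)   = sym (vertex-balance (s≤s z≤n) (top a) (pathSum root) refl)
  solves le (ext w b) = sym (vertex-balance le (ext w b) (pathSum w) refl)

exponent-divides : ∀ q g N →
  suc q Nat.* q ^ suc g Nat.* repunit q (suc (suc g)) ∣ N →
  (∀ r → r < suc g → repunit q (suc (suc r)) Nat.* repunit q (suc r) ∣ N) →
  ExponentDivides (suc q) (suc g) N
exponent-divides q g N root∣N consecutive∣N x = S.solution , S.solves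
  where
  n : ℕ → ℕ
  n r = N / (repunit q (suc (suc r)) Nat.* repunit q (suc r))

  module S = Solution q g N (_∣_.quotient root∣N) n (_∣_.equality root∣N)
                      (λ r r<h → sym (m/n*n≡m (consecutive∣N r r<h))) x

proposition7p5 : (d h : ℕ) → 3 ≤ d → 1 ≤ h → ExponentDivides d h (bound d h)
proposition7p5 _ _ (s≤s (s≤s (s≤s {n = e} _))) (s≤s {n = g} _) =
  exponent-divides (suc (suc e)) g (bound (3 Nat.+ e) (suc g)) (root∣bound e (suc g)) (consecutive∣bound e (suc g))
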